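{- For every integer $k \geq 1$, let $b(k)$ denote the greatest common divisor of all the integers $\sum_{i=1}^{k} b_{n+i}$ for $n \geq 0$. Then $$b(k) = \begin{cases} \gcd(P_k, k), & \text{if } k \text{ is even};\\ 2\gcd(Q_k, k), & \text{if } k \text{ is odd}.\end{cases}$$
   Context: The cobalancing sequence $(b_n)_{n\ge 0}$ is defined by $b_0=0$, $b_1=0$, $b_n=6b_{n-1}-b_{n-2}+2$ for $n\ge 2$. The Pell sequence $(P_n)_{n\ge 0}$ is defined by $P_0=0$, $P_1=1$, $P_n=2P_{n-1}+P_{n-2}$; the associated Pell sequence $(Q_n)_{n\ge 0}$ by $Q_0=1$, $Q_1=1$, $Q_n=2Q_{n-1}+Q_{n-2}$. -}

module Defs where

open import Data.Nat using (ℕ; zero; suc; _+_; _*_; _∸_)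
open import Data.Nat.Divisibility using (_∣_)
open import Data.Nat.GCD using (gcd)
open import Data.Bool using (Bool; true; false; if_then_else_)
open import Data.Nat using (_%_)

-- cobalancing numbers: b 0 = 0, b 1 = 0, b (n+2) = 6 b (n+1) - b n + 2
-- (in ℕ: the sequence is nondecreasing so 6 b(n+1) + 2 ∸ b n is exact subtraction)
cob : ℕ → ℕ
cob 0 = 0
cob 1 = 0
cob (suc (suc n)) = (6 * cob (suc n) + 2) ∸ cob n

pell : ℕ → ℕ
pell 0 = 0
pell 1 = 1
pell (suc (suc n)) = 2 * pell (suc n) + pell n

-- associated Pell numbers
apell : ℕ → ℕ
apell 0 = 1
apell 1 = 1
apell (suc (suc n)) = 2 * apell (suc n) + apell n

cobSum : ℕ → ℕ → ℕ
cobSum zero n = 0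
cobSum (suc k) n = cobSum k n + cob (n + suc k)

IsGCDOfAll : (ℕ → ℕ) → ℕ → Set
IsGCDOfAll f d = (∀ n → d ∣ f n) × (∀ c → (∀ n → c ∣ f n) → c ∣ d)
  where open import Data.Product using (_×_)

-- Since 2 b(m+1) + 1 = P(2m+1), the sums telescope to P(2n+2k) − P(2n) = 2(2 S + k), where
-- S = Σ_{i=1}^{k} b(n+i).  The addition formulas together with Q_k² − 2 P_k² = (−1)^k turn
-- this into 2 S + k = P_k Q(2n+k) for even k and 2 S + k = Q_k P(2n+k) for odd k.
-- A common divisor of all the sums divides their differences P_k Q(2n+k+1) (resp.
-- Q_k P(2n+k+1)); descending with G(m+4) + G(m) = 6 G(m+2) reaches Q_1 = 1 (resp. P_2 = 2),
-- and the case n = 0 then supplies the factor k.  Conversely gcd(P_k, k) divides 2 S, and the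
-- factor 2 is removed because P_k and k have the same 2-adic valuation (even k), or because
-- k is odd and all cobalancing numbers are even (odd k).

module Submission where

open import Defs
open import Data.Nat using (ℕ; zero; suc; _+_; _*_; _∸_; _^_; _≤_; _<_; _≥_; _>_; _%_; _/_; NonZero; >-nonZero)
open import Data.Nat.Properties
open import Data.Nat.Divisibility
open import Data.Nat.GCD using (gcd; gcd[m,n]∣m; gcd[m,n]∣n; gcd-greatest; c*gcd[m,n]≡gcd[cm,cn])
open import Data.Nat.DivMod using (m≡m%n+[m/n]*n)
open import Data.Nat.Induction using (<-wellFounded; Acc; acc)
open import Data.Nat.Tactic.RingSolver using (solve-∀)
open import Data.Product using (_×_; _,_; ∃-syntax; ∃₂)
open import Data.Sum using (_⊎_; inj₁; inj₂)
open import Relation.Binary.PropositionalEquality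

private variable
  a b c d m n A B X Y : ℕ

+-*2≡+-+ : ∀ a k → a + k * 2 ≡ a + k + k
+-*2≡+-+ = solve-∀

2*-+-cancelʳ-≡ : ∀ x y z → 2 * x + z ≡ 2 * y + z → x ≡ y
2*-+-cancelʳ-≡ x y z eq = *-cancelˡ-≡ x y 2 (+-cancelʳ-≡ z (2 * x) (2 * y) eq)

Odd : ℕ → Set
Odd n = ∃[ t ] n ≡ suc (t * 2)

parity : ∀ n → ∃[ j ] (n ≡ j * 2 ⊎ n ≡ suc (j * 2))
parity zero = 0 , inj₁ refl
parity (suc n) with parity n
... | j , inj₁ refl = j , inj₂ refl
... | j , inj₂ refl = suc j , inj₁ refl

odd-* : Odd m → Odd n → Odd (m * n)
odd-* (s , refl) (t , refl) = s + t + s * t * 2 , expand s t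
  where
  expand : ∀ s t → suc (s * 2) * suc (t * 2) ≡ suc ((s + t + s * t * 2) * 2)
  expand = solve-∀

odd-2*+ : ∀ x → Odd n → Odd (2 * x + n)
odd-2*+ x (t , refl) = x + t , expand x t
  where
  expand : ∀ x t → 2 * x + suc (t * 2) ≡ suc ((x + t) * 2)
  expand = solve-∀

∣-cancel-odd : Odd A → d ∣ m * A → d ∣ 2 * m → d ∣ m
∣-cancel-odd {d = d} {m = m} (a , refl) d∣mA d∣2m =
  ∣m+n∣m⇒∣n (subst (d ∣_) (expand m a) d∣mA) (∣m⇒∣m*n a d∣2m)
  where
  expand : ∀ m a → m * suc (a * 2) ≡ 2 * m * a + m
  expand = solve-∀

two-adic : ∀ n → .{{NonZero n}} → ∃₂ λ v B → n ≡ 2 ^ v * B × Odd B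
two-adic n = go n (<-wellFounded n)
  where
  go : ∀ n → .{{NonZero n}} → Acc _<_ n → ∃₂ λ v B → n ≡ 2 ^ v * B × Odd B
  go n (acc rec) with parity n
  ... | j , inj₂ refl = 0 , n , sym (*-identityˡ n) , j , refl
  ... | j , inj₁ refl with go j {{m*n≢0⇒m≢0 j}} (rec (m<m*n j 2 {{m*n≢0⇒m≢0 j}} ≤-refl))
  ...   | v , B , refl , odd-B = suc v , B , shift (2 ^ v) B , odd-B
    where
    shift : ∀ x B → x * B * 2 ≡ 2 * x * B
    shift = solve-∀

-- Pell and associated Pell numbers

P Q : ℕ → ℕ
P = pell
Q = apell

PellRecurrence : (ℕ → ℕ) → Set
PellRecurrence G = ∀ m → G (2 + m) ≡ 2 * G (1 + m) + G m

pell-recurrence : PellRecurrence P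
pell-recurrence _ = refl

apell-recurrence : PellRecurrence Q
apell-recurrence _ = refl

PellRecurrence⇒skip : ∀ (G : ℕ → ℕ) → PellRecurrence G → ∀ m → G (4 + m) + G m ≡ 6 * G (2 + m)
PellRecurrence⇒skip G rec m rewrite rec (2 + m) | rec (1 + m) | rec m =
  expand (G (1 + m)) (G m)
  where
  expand : ∀ x y → 2 * (2 * (2 * x + y) + x) + (2 * x + y) + y ≡ 6 * (2 * x + y)
  expand = solve-∀

mutual
  pell-suc : ∀ m → P (suc m) ≡ P m + Q m
  pell-suc zero = refl
  pell-suc (suc m) rewrite pell-suc m | apell-suc m = expand (P m) (Q m)
    where
    expand : ∀ p q → 2 * (p + q) + p ≡ (p + q) + (q + 2 * p)
    expand = solve-∀

  apell-suc : ∀ m → Q (suc m) ≡ Q m + 2 * P m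
  apell-suc zero = refl
  apell-suc (suc m) rewrite pell-suc m | apell-suc m = expand (P m) (Q m)
    where
    expand : ∀ p q → 2 * (q + 2 * p) + q ≡ (q + 2 * p) + 2 * (p + q)
    expand = solve-∀

pell-+ : ∀ a b → P (a + b) ≡ P a * Q b + Q a * P b
apell-+ : ∀ a b → Q (a + b) ≡ Q a * Q b + 2 * (P a * P b)

pell-+ zero b = sym (+-identityʳ (P b))
pell-+ (suc a) b
  rewrite pell-suc (a + b) | pell-+ a b | apell-+ a b | pell-suc a | apell-suc a =
  expand (P a) (Q a) (P b) (Q b)
  where
  expand : ∀ pa qa pb qb → (pa * qb + qa * pb) + (qa * qb + 2 * (pa * pb))
                         ≡ (pa + qa) * qb + (qa + 2 * pa) * pb
  expand = solve-∀

apell-+ zero b = sym (trans (+-identityʳ (1 * Q b)) (*-identityˡ (Q b)))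
apell-+ (suc a) b
  rewrite apell-suc (a + b) | pell-+ a b | apell-+ a b | pell-suc a | apell-suc a =
  expand (P a) (Q a) (P b) (Q b)
  where
  expand : ∀ pa qa pb qb → (qa * qb + 2 * (pa * pb)) + 2 * (pa * qb + qa * pb)
                         ≡ (qa + 2 * pa) * qb + 2 * ((pa + qa) * pb)
  expand = solve-∀

pell-*2 : ∀ m → P (m * 2) ≡ 2 * (P m * Q m)
pell-*2 m = begin
  P (m * 2)              ≡⟨ cong P (+-*2≡+-+ 0 m) ⟩
  P (m + m)              ≡⟨ pell-+ m m ⟩
  P m * Q m + Q m * P m  ≡⟨ collect (P m) (Q m) ⟩
  2 * (P m * Q m)        ∎
  where
  open ≡-Reasoning
  collect : ∀ p q → p * q + q * p ≡ 2 * (p * q)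
  collect = solve-∀

+1-cancel : a + m ≡ b + n → n ≡ m + 1 → a ≡ b + 1
+1-cancel {a} {m} {b} {n} eq refl = +-cancelʳ-≡ m a (b + 1) (trans eq (shift b m))
  where
  shift : ∀ b m → b + (m + 1) ≡ b + 1 + m
  shift = solve-∀

apell²+apell² : ∀ m → Q (suc m) * Q (suc m) + Q m * Q m
                    ≡ 2 * (P (suc m) * P (suc m)) + 2 * (P m * P m)
apell²+apell² m rewrite pell-suc m | apell-suc m = expand (P m) (Q m)
  where
  expand : ∀ p q → (q + 2 * p) * (q + 2 * p) + q * q ≡ 2 * ((p + q) * (p + q)) + 2 * (p * p)
  expand = solve-∀

mutual
  pell-cassini-even : ∀ j → Q (j * 2) * Q (j * 2) ≡ 2 * (P (j * 2) * P (j * 2)) + 1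
  pell-cassini-even zero = refl
  pell-cassini-even (suc j) = +1-cancel (apell²+apell² (suc (j * 2))) (pell-cassini-odd j)

  pell-cassini-odd : ∀ j → 2 * (P (suc (j * 2)) * P (suc (j * 2)))
                         ≡ Q (suc (j * 2)) * Q (suc (j * 2)) + 1
  pell-cassini-odd j = +1-cancel (sym (apell²+apell² (j * 2))) (pell-cassini-even j)

apell-odd : ∀ m → Odd (Q m)
apell-odd zero = 0 , refl
apell-odd (suc zero) = 0 , refl
apell-odd (suc (suc m)) = odd-2*+ (Q (suc m)) (apell-odd m)

pell-odd : ∀ j → Odd (P (suc (j * 2)))
pell-odd zero = 0 , refl
pell-odd (suc j) = odd-2*+ (P (suc (suc (j * 2)))) (pell-odd j)

pell-2-adic : ∀ v → Odd B → ∃[ A ] P (2 ^ v * B) ≡ 2 ^ v * A × Odd A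
pell-2-adic {B} zero odd-B@(t , refl) =
  P B , trans (cong P (*-identityˡ B)) (sym (*-identityˡ (P B))) , pell-odd t
pell-2-adic {B} (suc v) odd-B with pell-2-adic v odd-B
... | A , eq , odd-A = A * Q (2 ^ v * B) , chain , odd-* odd-A (apell-odd (2 ^ v * B))
  where
  open ≡-Reasoning
  x = 2 ^ v
  reorder : ∀ x B → 2 * x * B ≡ x * B * 2
  reorder = solve-∀
  regroup : ∀ x A y → 2 * (x * A * y) ≡ 2 * x * (A * y)
  regroup = solve-∀
  chain : P (2 * x * B) ≡ 2 * x * (A * Q (x * B))
  chain = begin
    P (2 * x * B)               ≡⟨ cong P (reorder x B) ⟩
    P (x * B * 2)               ≡⟨ pell-*2 (x * B) ⟩
    2 * (P (x * B) * Q (x * B)) ≡⟨ cong (λ y → 2 * (y * Q (x * B))) eq ⟩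
    2 * (x * A * Q (x * B))     ≡⟨ regroup x A (Q (x * B)) ⟩
    2 * x * (A * Q (x * B))     ∎

pell-sub-even : ∀ {k} → Q k * Q k ≡ 2 * (P k * P k) + 1 →
                ∀ a → P (a + k) * Q k ≡ Q (a + k) * P k + P a
pell-sub-even {k} cassini a rewrite pell-+ a k | apell-+ a k = begin
  (P a * Q k + Q a * P k) * Q k             ≡⟨ expand (P a) (Q a) (P k) (Q k) ⟩
  P a * (Q k * Q k) + Q a * Q k * P k       ≡⟨ cong (λ x → P a * x + Q a * Q k * P k) cassini ⟩
  P a * (2 * (P k * P k) + 1) + Q a * Q k * P k ≡⟨ collect (P a) (Q a) (P k) (Q k) ⟩
  (Q a * Q k + 2 * (P a * P k)) * P k + P a ∎
  where
  open ≡-Reasoning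
  expand : ∀ pa qa pk qk → (pa * qk + qa * pk) * qk ≡ pa * (qk * qk) + qa * qk * pk
  expand = solve-∀
  collect : ∀ pa qa pk qk → pa * (2 * (pk * pk) + 1) + qa * qk * pk
                          ≡ (qa * qk + 2 * (pa * pk)) * pk + pa
  collect = solve-∀

pell-sub-odd : ∀ {k} → 2 * (P k * P k) ≡ Q k * Q k + 1 →
               ∀ a → Q (a + k) * P k ≡ P (a + k) * Q k + P a
pell-sub-odd {k} cassini a rewrite pell-+ a k | apell-+ a k = begin
  (Q a * Q k + 2 * (P a * P k)) * P k       ≡⟨ expand (P a) (Q a) (P k) (Q k) ⟩
  P a * (2 * (P k * P k)) + Q a * Q k * P k ≡⟨ cong (λ x → P a * x + Q a * Q k * P k) cassini ⟩
  P a * (Q k * Q k + 1) + Q a * Q k * P k   ≡⟨ collect (P a) (Q a) (P k) (Q k) ⟩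
  (P a * Q k + Q a * P k) * Q k + P a       ∎
  where
  open ≡-Reasoning
  expand : ∀ pa qa pk qk → (qa * qk + 2 * (pa * pk)) * pk ≡ pa * (2 * (pk * pk)) + qa * qk * pk
  expand = solve-∀
  collect : ∀ pa qa pk qk → pa * (qk * qk + 1) + qa * qk * pk ≡ (pa * qk + qa * pk) * qk + pa
  collect = solve-∀

pell-shift-even : ∀ {k} → Q k * Q k ≡ 2 * (P k * P k) + 1 →
                  ∀ a → P (a + k + k) ≡ 2 * (P k * Q (a + k)) + P a
pell-shift-even {k} cassini a = begin
  P (a + k + k)                                 ≡⟨ pell-+ (a + k) k ⟩
  P (a + k) * Q k + Q (a + k) * P k             ≡⟨ cong (_+ Q (a + k) * P k) (pell-sub-even cassini a) ⟩
  Q (a + k) * P k + P a + Q (a + k) * P k       ≡⟨ collect (Q (a + k)) (P k) (P a) ⟩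
  2 * (P k * Q (a + k)) + P a                   ∎
  where
  open ≡-Reasoning
  collect : ∀ q p a → q * p + a + q * p ≡ 2 * (p * q) + a
  collect = solve-∀

pell-shift-odd : ∀ {k} → 2 * (P k * P k) ≡ Q k * Q k + 1 →
                 ∀ a → P (a + k + k) ≡ 2 * (Q k * P (a + k)) + P a
pell-shift-odd {k} cassini a = begin
  P (a + k + k)                                 ≡⟨ pell-+ (a + k) k ⟩
  P (a + k) * Q k + Q (a + k) * P k             ≡⟨ cong (P (a + k) * Q k +_) (pell-sub-odd cassini a) ⟩
  P (a + k) * Q k + (P (a + k) * Q k + P a)     ≡⟨ collect (P (a + k)) (Q k) (P a) ⟩
  2 * (Q k * P (a + k)) + P a                   ∎
  where
  open ≡-Reasoning
  collect : ∀ p q a → p * q + (p * q + a) ≡ 2 * (q * p) + a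
  collect = solve-∀

-- Cobalancing numbers

∸-recurrence : ∀ {c₁ c₂} → c₁ ≤ c₂ →
               2 * ((6 * c₂ + 2) ∸ c₁) + 1 + (2 * c₁ + 1) ≡ 6 * (2 * c₂ + 1)
∸-recurrence {c₁} {c₂} c₁≤c₂ = begin
  2 * x + 1 + (2 * c₁ + 1) ≡⟨ regroup x c₁ ⟩
  2 * (x + c₁) + 2         ≡⟨ cong (λ y → 2 * y + 2) (m∸n+n≡m c₁≤6c₂+2) ⟩
  2 * (6 * c₂ + 2) + 2     ≡⟨ expand c₂ ⟩
  6 * (2 * c₂ + 1)         ∎
  where
  open ≡-Reasoning
  x = (6 * c₂ + 2) ∸ c₁
  c₁≤6c₂+2 : c₁ ≤ 6 * c₂ + 2
  c₁≤6c₂+2 = ≤-trans c₁≤c₂ (≤-trans (m≤n*m c₂ 6) (m≤m+n (6 * c₂) 2))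
  regroup : ∀ x c → 2 * x + 1 + (2 * c + 1) ≡ 2 * (x + c) + 2
  regroup = solve-∀
  expand : ∀ c → 2 * (6 * c + 2) + 2 ≡ 6 * (2 * c + 1)
  expand = solve-∀

cob-pell-step : ∀ m → 2 * cob (1 + m) + 1 ≡ P (1 + m * 2) → 2 * cob (2 + m) + 1 ≡ P (3 + m * 2) →
                2 * cob (3 + m) + 1 ≡ P (5 + m * 2)
cob-pell-step m e₁ e₂ = +-cancelʳ-≡ (P (1 + m * 2)) _ _ (begin
  2 * cob (3 + m) + 1 + P (1 + m * 2)  ≡⟨ cong (2 * cob (3 + m) + 1 +_) (sym e₁) ⟩
  2 * cob (3 + m) + 1 + (2 * c₁ + 1)   ≡⟨ ∸-recurrence c₁≤c₂ ⟩
  6 * (2 * c₂ + 1)                     ≡⟨ cong (6 *_) e₂ ⟩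
  6 * P (3 + m * 2)                    ≡⟨ sym (PellRecurrence⇒skip P pell-recurrence (1 + m * 2)) ⟩
  P (5 + m * 2) + P (1 + m * 2)        ∎)
  where
  open ≡-Reasoning
  c₁ = cob (1 + m)
  c₂ = cob (2 + m)
  -- monotonicity of cob, which makes the truncated subtraction in its recurrence exact
  c₁≤c₂ : c₁ ≤ c₂
  c₁≤c₂ = *-cancelˡ-≤ 2 (+-cancelʳ-≤ 1 (2 * c₁) (2 * c₂)
            (subst₂ _≤_ (sym e₁) (sym e₂) (m≤n+m (P (1 + m * 2)) (2 * P (2 + m * 2)))))

cob-pell : ∀ m → 2 * cob (suc m) + 1 ≡ P (suc (m * 2))
cob-pell zero = refl
cob-pell (suc zero) = refl
cob-pell (suc (suc m)) = cob-pell-step m (cob-pell m) (cob-pell (suc m))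

cob-even : ∀ m → 2 ∣ cob m
cob-even zero = divides 0 refl
cob-even (suc zero) = divides 0 refl
cob-even (suc (suc m)) with cob-even m | cob-even (suc m)
... | divides a eq-a | divides b eq-b = divides ((6 * b + 1) ∸ a) (begin
  (6 * cob (suc m) + 2) ∸ cob m  ≡⟨ cong₂ (λ x y → (6 * x + 2) ∸ y) eq-b eq-a ⟩
  (6 * (b * 2) + 2) ∸ a * 2      ≡⟨ cong (_∸ a * 2) (expand b) ⟩
  (6 * b + 1) * 2 ∸ a * 2        ≡⟨ sym (*-distribʳ-∸ 2 (6 * b + 1) a) ⟩
  ((6 * b + 1) ∸ a) * 2          ∎)
  where
  open ≡-Reasoning
  expand : ∀ b → 6 * (b * 2) + 2 ≡ (6 * b + 1) * 2
  expand = solve-∀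

cobSum-even : ∀ k n → 2 ∣ cobSum k n
cobSum-even zero n = divides 0 refl
cobSum-even (suc k) n = ∣m∣n⇒∣m+n (cobSum-even k n) (cob-even (n + suc k))

cobSum-pell : ∀ k n → P (n * 2 + k * 2) ≡ 2 * (2 * cobSum k n + k) + P (n * 2)
cobSum-pell zero n = cong P (+-identityʳ (n * 2))
cobSum-pell (suc k) n = begin
  P (n * 2 + suc k * 2)                                    ≡⟨ cong P (shift n k) ⟩
  2 * P (suc z) + P z                                      ≡⟨ cong₂ (λ x y → 2 * x + y) (sym new-term) (cobSum-pell k n) ⟩
  2 * (2 * new + 1) + (2 * (2 * cobSum k n + k) + P (n * 2)) ≡⟨ collect new (cobSum k n) k (P (n * 2)) ⟩
  2 * (2 * (cobSum k n + new) + suc k) + P (n * 2)           ∎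
  where
  open ≡-Reasoning
  z = n * 2 + k * 2
  new = cob (n + suc k)
  shift : ∀ n k → n * 2 + suc k * 2 ≡ 2 + (n * 2 + k * 2)
  shift = solve-∀
  new-term : 2 * new + 1 ≡ P (suc z)
  new-term rewrite +-suc n k | sym (*-distribʳ-+ 2 n k) = cob-pell (n + k)
  collect : ∀ b S k p → 2 * (2 * b + 1) + (2 * (2 * S + k) + p) ≡ 2 * (2 * (S + b) + suc k) + p
  collect = solve-∀

cobSum-closed-even : ∀ j n → 2 * cobSum (j * 2) n + j * 2 ≡ P (j * 2) * Q (n * 2 + j * 2)
cobSum-closed-even j n = 2*-+-cancelʳ-≡ _ _ (P (n * 2)) (begin
  2 * (2 * cobSum k n + k) + P (n * 2) ≡⟨ sym (cobSum-pell k n) ⟩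
  P (n * 2 + k * 2)                    ≡⟨ cong P (+-*2≡+-+ (n * 2) k) ⟩
  P (n * 2 + k + k)                    ≡⟨ pell-shift-even (pell-cassini-even j) (n * 2) ⟩
  2 * (P k * Q (n * 2 + k)) + P (n * 2) ∎)
  where
  open ≡-Reasoning
  k = j * 2

cobSum-closed-odd : ∀ j n → 2 * cobSum (suc (j * 2)) n + suc (j * 2)
                           ≡ Q (suc (j * 2)) * P (n * 2 + suc (j * 2))
cobSum-closed-odd j n = 2*-+-cancelʳ-≡ _ _ (P (n * 2)) (begin
  2 * (2 * cobSum k n + k) + P (n * 2) ≡⟨ sym (cobSum-pell k n) ⟩
  P (n * 2 + k * 2)                    ≡⟨ cong P (+-*2≡+-+ (n * 2) k) ⟩
  P (n * 2 + k + k)                    ≡⟨ pell-shift-odd (pell-cassini-odd j) (n * 2) ⟩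
  2 * (Q k * P (n * 2 + k)) + P (n * 2) ∎)
  where
  open ≡-Reasoning
  k = suc (j * 2)

sum-increment : ∀ {k} (s G : ℕ → ℕ) X → PellRecurrence G →
                (∀ n → 2 * s n + k ≡ X * G (n * 2 + k)) →
                ∀ n → s (suc n) ≡ s n + X * G (suc (n * 2 + k))
sum-increment {k} s G X rec closed n = 2*-+-cancelʳ-≡ _ _ k (begin
  2 * s (suc n) + k                     ≡⟨ closed (suc n) ⟩
  X * G (2 + z)                         ≡⟨ cong (X *_) (rec z) ⟩
  X * (2 * G (1 + z) + G z)             ≡⟨ distribute X (G (1 + z)) (G z) ⟩
  2 * (X * G (1 + z)) + X * G z         ≡⟨ cong (2 * (X * G (1 + z)) +_) (sym (closed n)) ⟩
  2 * (X * G (1 + z)) + (2 * s n + k)   ≡⟨ collect (X * G (1 + z)) (s n) k ⟩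
  2 * (s n + X * G (1 + z)) + k         ∎)
  where
  open ≡-Reasoning
  z = n * 2 + k
  distribute : ∀ x g₁ g₀ → x * (2 * g₁ + g₀) ≡ 2 * (x * g₁) + x * g₀
  distribute = solve-∀
  collect : ∀ y t k → 2 * y + (2 * t + k) ≡ 2 * (t + y) + k
  collect = solve-∀

∣-increments : ∀ {k} (s G : ℕ → ℕ) X → PellRecurrence G →
               (∀ n → 2 * s n + k ≡ X * G (n * 2 + k)) → (∀ n → c ∣ s n) →
               ∀ n → c ∣ X * G (suc (n * 2 + k))
∣-increments {c = c} s G X rec closed c∣s n =
  ∣m+n∣m⇒∣n (subst (c ∣_) (sum-increment s G X rec closed n) (c∣s (suc n))) (c∣s n)

∣-descent : ∀ (G : ℕ → ℕ) X → PellRecurrence G → ∀ i r →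
            c ∣ X * G (r + i * 2) → c ∣ X * G (2 + (r + i * 2)) → c ∣ X * G r
∣-descent {c} G X rec zero r h₀ h₂ = subst (λ x → c ∣ X * G x) (+-identityʳ r) h₀
∣-descent {c} G X rec (suc i) r h₀ h₂ = ∣-descent G X rec i r lower h₀′
  where
  base = r + i * 2
  shift : ∀ r i → r + suc i * 2 ≡ 2 + (r + i * 2)
  shift = solve-∀
  h₀′ : c ∣ X * G (2 + base)
  h₀′ = subst (λ x → c ∣ X * G x) (shift r i) h₀
  h₂′ : c ∣ X * G (4 + base)
  h₂′ = subst (λ x → c ∣ X * G (2 + x)) (shift r i) h₂
  skip : 6 * (X * G (2 + base)) ≡ X * G (4 + base) + X * G base
  skip = begin
    6 * (X * G (2 + base))         ≡⟨ x*y*z≡y*[x*z] 6 X (G (2 + base)) ⟩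
    X * (6 * G (2 + base))         ≡⟨ cong (X *_) (sym (PellRecurrence⇒skip G rec base)) ⟩
    X * (G (4 + base) + G base)    ≡⟨ *-distribˡ-+ X (G (4 + base)) (G base) ⟩
    X * G (4 + base) + X * G base  ∎
    where
    open ≡-Reasoning
    x*y*z≡y*[x*z] : ∀ x y z → x * (y * z) ≡ y * (x * z)
    x*y*z≡y*[x*z] = solve-∀
  lower : c ∣ X * G base
  lower = ∣m+n∣m⇒∣n (subst (c ∣_) skip (∣n⇒∣m*n 6 h₀′)) h₂′

odd-gap-multiple : Odd A → Odd B → 2 * m + n * A ≡ n * B → n ∣ m
odd-gap-multiple {m = m} {n} (a , refl) (b , refl) eq = divides (b ∸ a) (begin
  m                 ≡⟨ sym (m+n∸n≡m m (a * n)) ⟩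
  m + a * n ∸ a * n ≡⟨ cong (_∸ a * n) halved ⟩
  b * n ∸ a * n     ≡⟨ sym (*-distribʳ-∸ n b a) ⟩
  (b ∸ a) * n       ∎)
  where
  open ≡-Reasoning
  lhs : ∀ m n a → n + 2 * (m + a * n) ≡ 2 * m + n * suc (a * 2)
  lhs = solve-∀
  rhs : ∀ n b → n * suc (b * 2) ≡ n + 2 * (b * n)
  rhs = solve-∀
  halved : m + a * n ≡ b * n
  halved = *-cancelˡ-≡ _ _ 2 (+-cancelˡ-≡ n _ _ (trans (lhs m n a) (trans eq (rhs n b))))

∣-from-equal-2-adic : Odd A → Odd B → Odd Y → 2 * m + n * B ≡ n * A * Y →
                      d ∣ n * A → d ∣ n * B → d ∣ m
∣-from-equal-2-adic {A} {B} {Y} {m} {n} {d} odd-A odd-B odd-Y eq d∣nA d∣nB =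
  ∣-cancel-odd odd-A (∣-trans d∣nA (*-monoˡ-∣ A n∣m)) d∣2m
  where
  n∣m : n ∣ m
  n∣m = odd-gap-multiple odd-B (odd-* odd-A odd-Y) (trans eq (*-assoc n A Y))
  d∣2m : d ∣ 2 * m
  d∣2m = ∣m+n∣m⇒∣n (subst (d ∣_) (trans (sym eq) (+-comm (2 * m) (n * B))) (∣m⇒∣m*n Y d∣nA)) d∣nB

2*-∣-from-odd : ∀ {k} → Odd k → 2 ∣ m → 2 * m + k ≡ X * Y → d ∣ X → d ∣ k → 2 * d ∣ m
2*-∣-from-odd {m = m} {Y = Y} {d = d} {k = k} odd-k (divides t refl) eq d∣X d∣k =
  subst (2 * d ∣_) (*-comm 2 t) (*-monoʳ-∣ 2 d∣t)
  where
  d∣2m : d ∣ 2 * m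
  d∣2m = ∣m+n∣m⇒∣n (subst (d ∣_) (trans (sym eq) (+-comm (2 * m) k)) (∣m⇒∣m*n Y d∣X)) d∣k
  d∣m : d ∣ m
  d∣m = ∣-cancel-odd odd-k (∣n⇒∣m*n m d∣k) d∣2m
  d∣t : d ∣ t
  d∣t = ∣-cancel-odd odd-k (∣n⇒∣m*n t d∣k) (subst (d ∣_) (*-comm t 2) d∣m)

-- The greatest common divisor of the sums

cobSum-gcd-even : ∀ j → .{{NonZero (j * 2)}} → IsGCDOfAll (cobSum (j * 2)) (gcd (P (j * 2)) (j * 2))
cobSum-gcd-even j = lower , upper
  where
  k = j * 2
  closed = cobSum-closed-even j

  lower : ∀ n → gcd (P k) k ∣ cobSum k n
  lower n with two-adic k
  ... | v , B , k≡ , odd-B with pell-2-adic v odd-B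
  ... | A , Pk≡ , odd-A =
    ∣-from-equal-2-adic {n = 2 ^ v} odd-A odd-B (apell-odd (n * 2 + k)) eq
      (subst (gcd (P k) k ∣_) P≡ (gcd[m,n]∣m (P k) k))
      (subst (gcd (P k) k ∣_) k≡ (gcd[m,n]∣n (P k) k))
    where
    P≡ : P k ≡ 2 ^ v * A
    P≡ = trans (cong P k≡) Pk≡
    eq : 2 * cobSum k n + 2 ^ v * B ≡ 2 ^ v * A * Q (n * 2 + k)
    eq = trans (cong (2 * cobSum k n +_) (sym k≡)) (trans (closed n) (cong (_* Q (n * 2 + k)) P≡))

  upper : ∀ c → (∀ n → c ∣ cobSum k n) → c ∣ gcd (P k) k
  upper c c∣S = gcd-greatest c∣Pk c∣k
    where
    increments = ∣-increments (cobSum k) Q (P k) apell-recurrence closed c∣S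
    c∣Pk : c ∣ P k
    c∣Pk = subst (c ∣_) (*-identityʳ (P k))
             (∣-descent Q (P k) apell-recurrence j 1 (increments 0) (increments 1))
    c∣k : c ∣ k
    c∣k = ∣m+n∣m⇒∣n (subst (c ∣_) (sym (closed 0)) (∣m⇒∣m*n (Q k) c∣Pk)) (∣n⇒∣m*n 2 (c∣S 0))

cobSum-gcd-odd : ∀ j → IsGCDOfAll (cobSum (suc (j * 2))) (2 * gcd (Q (suc (j * 2))) (suc (j * 2)))
cobSum-gcd-odd j = lower , upper
  where
  k = suc (j * 2)
  closed = cobSum-closed-odd j

  lower : ∀ n → 2 * gcd (Q k) k ∣ cobSum k n
  lower n = 2*-∣-from-odd (j , refl) (cobSum-even k n) (closed n) (gcd[m,n]∣m (Q k) k) (gcd[m,n]∣n (Q k) k)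

  upper : ∀ c → (∀ n → c ∣ cobSum k n) → c ∣ 2 * gcd (Q k) k
  upper c c∣S = subst (c ∣_) (sym (c*gcd[m,n]≡gcd[cm,cn] 2 (Q k) k)) (gcd-greatest c∣2Qk c∣2k)
    where
    increments = ∣-increments (cobSum k) P (Q k) pell-recurrence closed c∣S
    c∣2Qk : c ∣ 2 * Q k
    c∣2Qk = subst (c ∣_) (*-comm (Q k) 2)
              (∣-descent P (Q k) pell-recurrence j 2 (increments 0) (increments 1))
    doubled : 2 * Q k * P k ≡ 2 * (2 * cobSum k 0) + 2 * k
    doubled = begin
      2 * Q k * P k                 ≡⟨ *-assoc 2 (Q k) (P k) ⟩
      2 * (Q k * P k)               ≡⟨ cong (2 *_) (sym (closed 0)) ⟩
      2 * (2 * cobSum k 0 + k)      ≡⟨ *-distribˡ-+ 2 (2 * cobSum k 0) k ⟩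
      2 * (2 * cobSum k 0) + 2 * k  ∎
      where open ≡-Reasoning
    c∣2k : c ∣ 2 * k
    c∣2k = ∣m+n∣m⇒∣n (subst (c ∣_) doubled (∣m⇒∣m*n (P k) c∣2Qk))
                      (∣n⇒∣m*n 2 (∣n⇒∣m*n 2 (c∣S 0)))

theorem28 : ∀ (k : ℕ) → k ≥ 1 →
    (k % 2 ≡ 0 → IsGCDOfAll (cobSum k) (gcd (pell k) k)) ×
    (k % 2 ≡ 1 → IsGCDOfAll (cobSum k) (2 * gcd (apell k) k))
theorem28 k k≥1 = even , odd
  where
  j = k / 2
  k≡k%2+j*2 : k ≡ k % 2 + j * 2
  k≡k%2+j*2 = m≡m%n+[m/n]*n k 2

  even : k % 2 ≡ 0 → IsGCDOfAll (cobSum k) (gcd (pell k) k)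
  even k%2≡0 = subst (λ m → IsGCDOfAll (cobSum m) (gcd (pell m) m)) (sym k≡j*2)
                 (cobSum-gcd-even j {{>-nonZero (subst (_> 0) k≡j*2 k≥1)}})
    where
    k≡j*2 : k ≡ j * 2
    k≡j*2 = trans k≡k%2+j*2 (cong (_+ j * 2) k%2≡0)

  odd : k % 2 ≡ 1 → IsGCDOfAll (cobSum k) (2 * gcd (apell k) k)
  odd k%2≡1 = subst (λ m → IsGCDOfAll (cobSum m) (2 * gcd (apell m) m)) (sym k≡1+j*2) (cobSum-gcd-odd j)
    where
    k≡1+j*2 : k ≡ suc (j * 2)
    k≡1+j*2 = trans k≡k%2+j*2 (cong (_+ j * 2) k%2≡1)
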